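{- Fix natural numbers $k\leq s$. Then for every natural number $n\geq k^2\binom{s}{k}+k$ we have $k\leq D(k,s,n)$.
   Context: For a natural number $n$, $[n]=\{1,\dots,n\}$, and for a set $A$ and $s\in\mathbb{N}$, $\binom{A}{s}$ denotes the set of $s$-element subsets of $A$. A set $A$ is shattered by a family $\mathcal{F}$ of sets if $\{A\cap S: S\in\mathcal{F}\}=2^A$. The VC-dimension of $\mathcal{F}$ is the size of the largest finite set shattered by $\mathcal{F}$. A family $\mathcal{F}\subseteq 2^X$ has the $k$-covering property if every $k$-element subset of $X$ is contained in some member of $\mathcal{F}$. For natural numbers $k\leq s\leq n$, $D(k,s,n)$ denotes the smallest VC-dimension of a family $\mathcal{F}\subseteq\binom{[n]}{s}$ having the $k$-covering property (as subsets of $[n]$). -}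

module Defs where

open import Data.Nat using (ℕ; _≤_)
open import Data.Fin.Subset using (Subset; _∩_; _⊆_; ∣_∣)
open import Data.List using (List)
open import Data.List.Membership.Propositional using (_∈_)
open import Data.List.Relation.Unary.All using (All)
open import Data.Product using (Σ; _×_)
open import Relation.Binary.PropositionalEquality using (_≡_)

-- Ground set [n] is modelled as Fin n; subsets of [n] as Subset n.
-- A (finite) family of subsets of [n] is a list of subsets.
Family : ℕ → Set
Family n = List (Subset n)

Shatters : ∀ {n} → Family n → Subset n → Set
Shatters F A = ∀ (B : _) → B ⊆ A → Σ _ λ S → S ∈ F × (A ∩ S ≡ B)

IsVCDim : ∀ {n} → Family n → ℕ → Set
IsVCDim F d =
  (Σ _ λ A → Shatters F A × ∣ A ∣ ≡ d) ×
  (∀ A → Shatters F A → ∣ A ∣ ≤ d)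

Uniform : ∀ {n} → ℕ → Family n → Set
Uniform s F = All (λ S → ∣ S ∣ ≡ s) F

KCovering : ∀ {n} → ℕ → Family n → Set
KCovering k F = ∀ K → ∣ K ∣ ≡ k → Σ _ λ S → S ∈ F × K ⊆ S

{-# OPTIONS --safe #-}
-- Suppose F shatters no k-set. By the Sauer–Shelah lemma F has at most
-- Φ n k = Σ_{i<k} C(n,i) ≤ k·C(n,k−1) distinct members. On the other hand every k-set lies in
-- a member of F and every member contains C(s,k) of them, so C(n,k) ≤ |F|·C(s,k). Since
-- k·C(n,k) = (n−k+1)·C(n,k−1) and n−k+1 > k²·C(s,k), the two bounds are incompatible.
module Submission where

open import Defs
open import Data.Nat using (ℕ; _≤_; _+_; _*_; _^_)
open import Data.Nat.Combinatorics using (_C_)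

open import Data.Bool as Bool using (Bool; true; false; T; _∧_; _∨_)
open import Data.Bool.Properties using (T-≡; T-∧; T-∨; ∧-zeroʳ)
open import Data.Empty using (⊥-elim)
open import Data.Fin.Subset using (Subset; _∩_; _⊆_; ∣_∣; ⊤; ⊥; inside; outside)
open import Data.Fin.Subset.Properties using (_⊆?_; ⊆⊤; ⊥⊆; ⊆-antisym; ∩-zeroˡ; drop-∷-⊆; ∣⊤∣≡n)
import Data.List.Membership.DecPropositional as DecMembership
open import Data.List.Relation.Unary.All using (lookup)
open import Data.Nat using (zero; suc; _<_; z≤n; s≤s; _≡ᵇ_)
open import Data.Nat.Combinatorics using (nCk+nC[k+1]≡[n+1]C[k+1])
open import Data.Nat.Properties
open import Algebra.Properties.CommutativeSemigroup +-commutativeSemigroup using (interchange)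
open import Data.Nat.Tactic.RingSolver using (solve-∀)
open import Data.Product using (_×_; _,_; ∃-syntax)
open import Data.Sum using (inj₁; inj₂)
open import Data.Vec using (_∷_; []; here)
open import Data.Vec.Properties using (≡-dec)
open import Function using (_∘_; Equivalence)
open import Relation.Binary.PropositionalEquality
open import Relation.Nullary using (¬_; does)
open import Relation.Nullary.Decidable using (⌊_⌋; dec-true; toWitness; fromWitness)

private
  variable
    n : ℕ

choose : ℕ → ℕ → ℕ
choose n       zero    = 1
choose zero    (suc k) = 0
choose (suc n) (suc k) = choose n k + choose n (suc k)

choose≡C : ∀ n k → choose n k ≡ n C k
choose≡C n       zero    = refl
choose≡C zero    (suc k) = refl
choose≡C (suc n) (suc k) =
  trans (cong₂ _+_ (choose≡C n k) (choose≡C n (suc k))) (nCk+nC[k+1]≡[n+1]C[k+1] n k)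

choose-pos : ∀ {n k} → k ≤ n → 0 < choose n k
choose-pos {k = zero}      _         = s≤s z≤n
choose-pos {suc n} {suc k} (s≤s k≤n) = ≤-trans (choose-pos k≤n) (m≤m+n _ _)

choose-1 : ∀ n → choose n 1 ≡ n
choose-1 zero    = refl
choose-1 (suc n) = cong suc (choose-1 n)

-- (i+1)·C(n,i+1) = (n−i)·C(n,i), stated without truncated subtraction.
choose-ratio : ∀ n i → suc i * choose n (suc i) + i * choose n i ≡ n * choose n i
choose-ratio zero    zero    = refl
choose-ratio zero    (suc i) = cong₂ _+_ (*-zeroʳ (2 + i)) (*-zeroʳ (suc i))
choose-ratio (suc n) zero    =
  trans (+-identityʳ _) (trans (*-comm 1 _) (cong (_* 1) (choose-1 (suc n))))
choose-ratio (suc n) (suc i) = begin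
  (2 + i) * (b + c) + (1 + i) * (a + b)
    ≡⟨ regroup i a b c ⟩
  ((2 + i) * c + (1 + i) * b) + ((1 + i) * b + i * a) + (a + b)
    ≡⟨ cong₂ (λ x y → x + y + (a + b)) (choose-ratio n (suc i)) (choose-ratio n i) ⟩
  n * b + n * a + (a + b)
    ≡⟨ collect n a b ⟩
  (1 + n) * (a + b) ∎
  where
  open ≡-Reasoning
  a = choose n i
  b = choose n (suc i)
  c = choose n (2 + i)
  regroup : ∀ i a b c → (2 + i) * (b + c) + (1 + i) * (a + b)
                      ≡ ((2 + i) * c + (1 + i) * b) + ((1 + i) * b + i * a) + (a + b)
  regroup = solve-∀
  collect : ∀ n a b → n * b + n * a + (a + b) ≡ (1 + n) * (a + b)
  collect = solve-∀

*-choose<*-choose-suc : ∀ {a j n} → a + suc j ≤ n → a * choose n j < suc j * choose n (suc j)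
*-choose<*-choose-suc {a} {j} {n} a+1+j≤n =
  +-cancelʳ-< (j * c) (a * c) (suc j * choose n (suc j)) (begin-strict
  a * c + j * c                     <⟨ +-monoˡ-< (j * c) (m<n+m (a * c) (choose-pos j≤n)) ⟩
  suc a * c + j * c                 ≡⟨ *-distribʳ-+ c (suc a) j ⟨
  (suc a + j) * c                   ≡⟨ cong (_* c) (+-suc a j) ⟨
  (a + suc j) * c                   ≤⟨ *-monoˡ-≤ c a+1+j≤n ⟩
  n * c                             ≡⟨ choose-ratio n j ⟨
  suc j * choose n (suc j) + j * c  ∎)
  where
  open ≤-Reasoning
  c = choose n j
  j≤n : j ≤ n
  j≤n = ≤-trans (n≤1+n j) (m+n≤o⇒n≤o a a+1+j≤n)

Φ : ℕ → ℕ → ℕ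
Φ n zero    = 0
Φ n (suc d) = Φ n d + choose n d

Φ-pascal : ∀ n d → Φ (suc n) (suc d) ≡ Φ n d + Φ n (suc d)
Φ-pascal n zero    = refl
Φ-pascal n (suc d) = begin
  Φ (suc n) (suc d) + choose (suc n) (suc d)               ≡⟨ cong (_+ choose (suc n) (suc d)) (Φ-pascal n d) ⟩
  (Φ n d + Φ n (suc d)) + (choose n d + choose n (suc d))  ≡⟨ interchange (Φ n d) _ _ _ ⟩
  (Φ n d + choose n d) + (Φ n (suc d) + choose n (suc d))  ∎
  where open ≡-Reasoning

Φ-pos : ∀ {n} d → 0 < Φ n (suc d)
Φ-pos zero    = ≤-refl
Φ-pos (suc d) = ≤-trans (Φ-pos d) (m≤m+n _ _)

Φ-bound : ∀ {n} i → i + i ≤ n → Φ n (suc i) ≤ suc i * choose n i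
Φ-bound zero    _             = ≤-refl
Φ-bound {n} (suc i) 1+i+1+i≤n = begin
  Φ n (suc i) + choose n (suc i)               ≤⟨ +-monoˡ-≤ _ (Φ-bound i i+i≤n) ⟩
  suc i * choose n i + choose n (suc i)        ≤⟨ +-monoˡ-≤ _ (*-monoʳ-≤ (suc i) step) ⟩
  suc i * choose n (suc i) + choose n (suc i)  ≡⟨ +-comm _ (choose n (suc i)) ⟩
  suc (suc i) * choose n (suc i)               ∎
  where
  open ≤-Reasoning
  i+i≤n : i + i ≤ n
  i+i≤n = ≤-trans (+-mono-≤ (n≤1+n i) (n≤1+n i)) 1+i+1+i≤n
  step : choose n i ≤ choose n (suc i)
  step = *-cancelˡ-≤ (suc i) (<⇒≤ (*-choose<*-choose-suc 1+i+1+i≤n))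

Φ*c<choose : ∀ {j c n} → 0 < c → suc j ^ 2 * c + suc j ≤ n → Φ n (suc j) * c < choose n (suc j)
Φ*c<choose {j} {c} {n} c>0 hyp = *-cancelˡ-< k (Φ n k * c) (choose n k) (begin-strict
  k * (Φ n k * c)           ≤⟨ *-monoʳ-≤ k (*-monoˡ-≤ c (Φ-bound j j+j≤n)) ⟩
  k * (k * choose n j * c)  ≡⟨ reassoc k (choose n j) c ⟩
  k ^ 2 * c * choose n j    <⟨ *-choose<*-choose-suc hyp ⟩
  k * choose n k            ∎)
  where
  open ≤-Reasoning
  k = suc j
  k≤k²c : k ≤ k ^ 2 * c
  k≤k²c = ≤-trans (≤-reflexive (sym (*-identityʳ k))) (*-mono-≤ (m≤m*n k (k * 1)) c>0)
  j+j≤n : j + j ≤ n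
  j+j≤n = ≤-trans (+-mono-≤ (≤-trans (n≤1+n j) k≤k²c) (n≤1+n j)) hyp
  -- x * (x * 1) is x ^ 2 unfolded.
  reassoc : ∀ x y z → x * (x * y * z) ≡ x * (x * 1) * z * y
  reassoc = solve-∀

∑ : (Subset n → ℕ) → ℕ
∑ {zero}  f = f []
∑ {suc n} f = ∑ (f ∘ (outside ∷_)) + ∑ (f ∘ (inside ∷_))

∑-cong : {f g : Subset n → ℕ} → (∀ x → f x ≡ g x) → ∑ f ≡ ∑ g
∑-cong {zero}  f≗g = f≗g []
∑-cong {suc n} f≗g = cong₂ _+_ (∑-cong (f≗g ∘ (outside ∷_))) (∑-cong (f≗g ∘ (inside ∷_)))

∑-mono : {f g : Subset n → ℕ} → (∀ x → f x ≤ g x) → ∑ f ≤ ∑ g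
∑-mono {zero}  f≤g = f≤g []
∑-mono {suc n} f≤g = +-mono-≤ (∑-mono (f≤g ∘ (outside ∷_))) (∑-mono (f≤g ∘ (inside ∷_)))

∑-zero : ∑ {n} (λ _ → 0) ≡ 0
∑-zero {zero}  = refl
∑-zero {suc n} = cong₂ _+_ (∑-zero {n}) (∑-zero {n})

∑-distrib-+ : (f g : Subset n → ℕ) → ∑ (λ x → f x + g x) ≡ ∑ f + ∑ g
∑-distrib-+ {zero}  f g = refl
∑-distrib-+ {suc n} f g = begin
  ∑ (λ x → f₀ x + g₀ x) + ∑ (λ x → f₁ x + g₁ x)  ≡⟨ cong₂ _+_ (∑-distrib-+ f₀ g₀) (∑-distrib-+ f₁ g₁) ⟩
  (∑ f₀ + ∑ g₀) + (∑ f₁ + ∑ g₁)                  ≡⟨ interchange (∑ f₀) (∑ g₀) (∑ f₁) (∑ g₁) ⟩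
  (∑ f₀ + ∑ f₁) + (∑ g₀ + ∑ g₁)                  ∎
  where
  open ≡-Reasoning
  f₀ f₁ g₀ g₁ : Subset n → ℕ
  f₀ = f ∘ (outside ∷_)
  f₁ = f ∘ (inside ∷_)
  g₀ = g ∘ (outside ∷_)
  g₁ = g ∘ (inside ∷_)

*-distribˡ-∑ : ∀ c (f : Subset n → ℕ) → ∑ (λ x → c * f x) ≡ c * ∑ f
*-distribˡ-∑ {zero}  c f = refl
*-distribˡ-∑ {suc n} c f =
  trans (cong₂ _+_ (*-distribˡ-∑ c (f ∘ (outside ∷_))) (*-distribˡ-∑ c (f ∘ (inside ∷_))))
        (sym (*-distribˡ-+ c (∑ (f ∘ (outside ∷_))) (∑ (f ∘ (inside ∷_)))))

∑-comm : ∀ {m} (f : Subset n → Subset m → ℕ) → ∑ (λ x → ∑ (f x)) ≡ ∑ (λ y → ∑ (λ x → f x y))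
∑-comm {zero}  f = refl
∑-comm {suc n} f =
  trans (cong₂ _+_ (∑-comm (f ∘ (outside ∷_))) (∑-comm (f ∘ (inside ∷_))))
        (sym (∑-distrib-+ (λ y → ∑ (λ x → f (outside ∷ x) y)) (λ y → ∑ (λ x → f (inside ∷ x) y))))

term≤∑ : (f : Subset n → ℕ) (x : Subset n) → f x ≤ ∑ f
term≤∑ f []            = ≤-refl
term≤∑ f (outside ∷ x) = ≤-trans (term≤∑ (f ∘ (outside ∷_)) x) (m≤m+n _ _)
term≤∑ f (inside  ∷ x) = ≤-trans (term≤∑ (f ∘ (inside ∷_)) x) (m≤n+m _ _)

𝟙 : Bool → ℕ
𝟙 false = 0
𝟙 true  = 1

𝟙-∧-∨ : ∀ a b → 𝟙 a + 𝟙 b ≡ 𝟙 (a ∧ b) + 𝟙 (a ∨ b)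
𝟙-∧-∨ false false = refl
𝟙-∧-∨ false true  = refl
𝟙-∧-∨ true  false = refl
𝟙-∧-∨ true  true  = refl

count : (Subset n → Bool) → ℕ
count P = ∑ (𝟙 ∘ P)

Shattersᵇ : (Subset n → Bool) → Subset n → Set
Shattersᵇ P A = ∀ B → B ⊆ A → ∃[ S ] T (P S) × A ∩ S ≡ B

VCDim< : (Subset n → Bool) → ℕ → Set
VCDim< P d = ∀ A → Shattersᵇ P A → ∣ A ∣ < d

shattersᵇ-⊥ : (P : Subset n → Bool) {S : Subset n} → T (P S) → Shattersᵇ P ⊥
shattersᵇ-⊥ P {S} PS B B⊆⊥ = S , PS , trans (∩-zeroˡ S) (⊆-antisym ⊥⊆ B⊆⊥)

count-VCDim<0 : (P : Subset n → Bool) → VCDim< P 0 → count P ≡ 0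
count-VCDim<0 {n} P vc = trans (∑-cong absent) (∑-zero {n})
  where
  absent : ∀ S → 𝟙 (P S) ≡ 0
  absent S with P S in PS≡true
  ... | false = refl
  ... | true  = ⊥-elim (n≮0 (vc ⊥ (shattersᵇ-⊥ P (Equivalence.from T-≡ PS≡true))))

module Split (P : Subset (suc n) → Bool) where

  Pᵒ Pⁱ P∧ P∨ : Subset n → Bool
  Pᵒ S = P (outside ∷ S)
  Pⁱ S = P (inside ∷ S)
  P∧ S = Pᵒ S ∧ Pⁱ S
  P∨ S = Pᵒ S ∨ Pⁱ S

  shatters-∧ : ∀ {A} → Shattersᵇ P∧ A → Shattersᵇ P (inside ∷ A)
  shatters-∧ sh (b ∷ B) B⊆A with sh B (drop-∷-⊆ B⊆A)
  ... | S , P∧S , A∩S≡B = b ∷ S , both b (Equivalence.to T-∧ P∧S) , cong (b ∷_) A∩S≡B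
    where
    both : ∀ b → T (Pᵒ S) × T (Pⁱ S) → T (P (b ∷ S))
    both outside (PᵒS , _) = PᵒS
    both inside  (_ , PⁱS) = PⁱS

  shatters-∨ : ∀ {A} → Shattersᵇ P∨ A → Shattersᵇ P (outside ∷ A)
  shatters-∨ sh (inside ∷ B) B⊆A with () ← B⊆A here
  shatters-∨ sh (outside ∷ B) B⊆A with sh B (drop-∷-⊆ B⊆A)
  ... | S , P∨S , A∩S≡B with Equivalence.to T-∨ P∨S
  ... | inj₁ PᵒS = outside ∷ S , PᵒS , cong (outside ∷_) A∩S≡B
  ... | inj₂ PⁱS = inside ∷ S , PⁱS , cong (outside ∷_) A∩S≡B

sauer-shelah : ∀ n d (P : Subset n → Bool) → VCDim< P d → count P ≤ Φ n d
sauer-shelah n       zero    P vc = ≤-reflexive (count-VCDim<0 P vc)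
sauer-shelah zero    (suc d) P vc = ≤-trans (𝟙≤1 (P [])) (Φ-pos d)
  where
  𝟙≤1 : ∀ b → 𝟙 b ≤ 1
  𝟙≤1 false = z≤n
  𝟙≤1 true  = ≤-refl
sauer-shelah (suc n) (suc d) P vc = begin
  ∑ (𝟙 ∘ Pᵒ) + ∑ (𝟙 ∘ Pⁱ)                ≡⟨ ∑-distrib-+ (𝟙 ∘ Pᵒ) (𝟙 ∘ Pⁱ) ⟨
  ∑ (λ S → 𝟙 (Pᵒ S) + 𝟙 (Pⁱ S))          ≡⟨ ∑-cong (λ S → 𝟙-∧-∨ (Pᵒ S) (Pⁱ S)) ⟩
  ∑ (λ S → 𝟙 (P∧ S) + 𝟙 (P∨ S))          ≡⟨ ∑-distrib-+ (𝟙 ∘ P∧) (𝟙 ∘ P∨) ⟩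
  count P∧ + count P∨                    ≤⟨ +-mono-≤ (sauer-shelah n d P∧ vc∧) (sauer-shelah n (suc d) P∨ vc∨) ⟩
  Φ n d + Φ n (suc d)                    ≡⟨ Φ-pascal n d ⟨
  Φ (suc n) (suc d)                      ∎
  where
  open ≤-Reasoning
  open Split P
  vc∧ : VCDim< P∧ d
  vc∧ A sh = ≤-pred (vc (inside ∷ A) (shatters-∧ sh))
  vc∨ : VCDim< P∨ (suc d)
  vc∨ A sh = vc (outside ∷ A) (shatters-∨ sh)

k-subsetᵇ : ℕ → Subset n → Subset n → Bool
k-subsetᵇ k S K = does (K ⊆? S) ∧ (∣ K ∣ ≡ᵇ k)

count-k-subsets : (S : Subset n) (k : ℕ) → count (k-subsetᵇ k S) ≡ choose ∣ S ∣ k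
count-k-subsets []            zero    = refl
count-k-subsets []            (suc k) = refl
count-k-subsets {suc n} (outside ∷ S) k =
  trans (cong₂ _+_ (count-k-subsets S k) (∑-zero {n})) (+-identityʳ _)
count-k-subsets {suc n} (inside ∷ S) zero =
  trans (cong₂ _+_ (count-k-subsets S zero) none) (+-identityʳ _)
  where
  none : ∑ (λ K → 𝟙 (does (K ⊆? S) ∧ false)) ≡ 0
  none = trans (∑-cong (λ K → cong 𝟙 (∧-zeroʳ (does (K ⊆? S))))) (∑-zero {n})
count-k-subsets (inside ∷ S) (suc k) =
  trans (cong₂ _+_ (count-k-subsets S (suc k)) (count-k-subsets S k))
        (+-comm (choose ∣ S ∣ (suc k)) (choose ∣ S ∣ k))

choose≤count*choose : ∀ {k s} (P : Subset n → Bool) →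
  (∀ S → T (P S) → ∣ S ∣ ≡ s) → (∀ K → ∣ K ∣ ≡ k → ∃[ S ] T (P S) × K ⊆ S) →
  choose n k ≤ count P * choose s k
choose≤count*choose {n} {k} {s} P uniform covering = begin
  choose n k                                    ≡⟨ cong (λ m → choose m k) (∣⊤∣≡n n) ⟨
  choose ∣ ⊤ {n} ∣ k                            ≡⟨ count-k-subsets {n} ⊤ k ⟨
  count (k-subsetᵇ {n} k ⊤)                     ≤⟨ ∑-mono covered ⟩
  ∑ (λ K → ∑ (λ S → 𝟙 (P S) * 𝟙 (K ⊆ₖ S)))      ≡⟨ ∑-comm (λ K S → 𝟙 (P S) * 𝟙 (K ⊆ₖ S)) ⟩
  ∑ (λ S → ∑ (λ K → 𝟙 (P S) * 𝟙 (K ⊆ₖ S)))      ≡⟨ ∑-cong (λ S → *-distribˡ-∑ (𝟙 (P S)) (𝟙 ∘ k-subsetᵇ k S)) ⟩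
  ∑ (λ S → 𝟙 (P S) * count (k-subsetᵇ k S))     ≡⟨ ∑-cong (λ S → cong (𝟙 (P S) *_) (count-k-subsets S k)) ⟩
  ∑ (λ S → 𝟙 (P S) * choose ∣ S ∣ k)            ≡⟨ ∑-cong uniform-term ⟩
  ∑ (λ S → choose s k * 𝟙 (P S))                ≡⟨ *-distribˡ-∑ (choose s k) (𝟙 ∘ P) ⟩
  choose s k * count P                          ≡⟨ *-comm (choose s k) (count P) ⟩
  count P * choose s k                          ∎
  where
  open ≤-Reasoning
  _⊆ₖ_ : Subset n → Subset n → Bool
  K ⊆ₖ S = k-subsetᵇ k S K

  covered : ∀ K → 𝟙 (K ⊆ₖ ⊤) ≤ ∑ (λ S → 𝟙 (P S) * 𝟙 (K ⊆ₖ S))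
  covered K rewrite dec-true (K ⊆? ⊤) ⊆⊤ with ∣ K ∣ ≡ᵇ k in ∣K∣≡ᵇk
  ... | false = z≤n
  ... | true with covering K (≡ᵇ⇒≡ ∣ K ∣ k (Equivalence.from T-≡ ∣K∣≡ᵇk))
  ...   | S , PS , K⊆S =
    ≤-trans (≤-reflexive (sym one)) (term≤∑ (λ S → 𝟙 (P S) * 𝟙 (does (K ⊆? S) ∧ true)) S)
    where
    one : 𝟙 (P S) * 𝟙 (does (K ⊆? S) ∧ true) ≡ 1
    one rewrite Equivalence.to T-≡ PS | dec-true (K ⊆? S) K⊆S = refl

  uniform-term : ∀ S → 𝟙 (P S) * choose ∣ S ∣ k ≡ choose s k * 𝟙 (P S)
  uniform-term S with P S in PS≡true
  ... | false = sym (*-zeroʳ (choose s k))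
  ... | true  = trans (cong (λ m → 1 * choose m k) (uniform S (Equivalence.from T-≡ PS≡true)))
                      (*-comm 1 (choose s k))

uniform-covering⇒¬VCDim< : ∀ {j s} (P : Subset n → Bool) → suc j ≤ s →
  suc j ^ 2 * choose s (suc j) + suc j ≤ n →
  (∀ S → T (P S) → ∣ S ∣ ≡ s) → (∀ K → ∣ K ∣ ≡ suc j → ∃[ S ] T (P S) × K ⊆ S) →
  ¬ VCDim< P (suc j)
uniform-covering⇒¬VCDim< {n} {j} {s} P k≤s n-large uniform covering vc =
  <⇒≱ (Φ*c<choose (choose-pos k≤s) n-large) (begin
    choose n k                ≤⟨ choose≤count*choose P uniform covering ⟩
    count P * choose s k      ≤⟨ *-monoˡ-≤ (choose s k) (sauer-shelah n k P vc) ⟩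
    Φ n k * choose s k        ∎)
  where
  open ≤-Reasoning
  k = suc j

module _ (F : Family n) where

  open DecMembership (≡-dec {n = n} Bool._≟_) using (_∈?_)

  -- Members of F are counted as the subsets satisfying ∈ᵇ, so repetitions in the list F are harmless.
  ∈ᵇ : Subset n → Bool
  ∈ᵇ S = ⌊ S ∈? F ⌋

  ∈ᵇ-uniform : ∀ {s} → Uniform s F → ∀ S → T (∈ᵇ S) → ∣ S ∣ ≡ s
  ∈ᵇ-uniform uniform S S∈F = lookup uniform (toWitness S∈F)

  ∈ᵇ-covering : ∀ {k} → KCovering k F → ∀ K → ∣ K ∣ ≡ k → ∃[ S ] T (∈ᵇ S) × K ⊆ S
  ∈ᵇ-covering covering K ∣K∣≡k with covering K ∣K∣≡k
  ... | S , S∈F , K⊆S = S , fromWitness S∈F , K⊆S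

  ∈ᵇ-VCDim< : ∀ {d k} → IsVCDim F d → d < k → VCDim< ∈ᵇ k
  ∈ᵇ-VCDim< (_ , maximal) d<k A sh = ≤-<-trans (maximal A shatters) d<k
    where
    shatters : Shatters F A
    shatters B B⊆A with sh B B⊆A
    ... | S , S∈F , A∩S≡B = S , toWitness S∈F , A∩S≡B

mainTheorem3 : (k s n : ℕ) → k ≤ s → s ≤ n → (k ^ 2) * (s C k) + k ≤ n →
    (F : Family n) → Uniform s F → KCovering k F →
    (d : ℕ) → IsVCDim F d → k ≤ d
mainTheorem3 zero    _ _ _   _ _       _ _       _        _ _  = z≤n
mainTheorem3 (suc j) s n k≤s _ n-large F uniform covering d vc = ≮⇒≥ λ d<k →
  uniform-covering⇒¬VCDim< (∈ᵇ F) k≤s n-large′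
    (∈ᵇ-uniform F uniform) (∈ᵇ-covering F covering) (∈ᵇ-VCDim< F vc d<k)
  where
  n-large′ : suc j ^ 2 * choose s (suc j) + suc j ≤ n
  n-large′ = subst (λ c → suc j ^ 2 * c + suc j ≤ n) (sym (choose≡C s (suc j))) n-large
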